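{- For any set $A$, let $\mathrm{Array}(A)=\sum_{n:\mathbb{N}}(\mathrm{Fin}(n)\to A)$, with unit $(0,\lambda\{\})$, generator map $\eta_A(a)=(1,\lambda\{0\mapsto a\})$, and concatenation $(n,f)\mathbin{++}(m,g)=(n+m,f\oplus g)$ where $(f\oplus g)(k)=f(k)$ if $k<n$ and $(f\oplus g)(k)=g(k-n)$ otherwise. Then $(\mathrm{Array}(A),\eta_A)$ is the free monoid on $A$: for every monoid $X$, the map sending a monoid homomorphism $f\colon\mathrm{Array}(A)\to X$ to $f\circ\eta_A$ is an equivalence between monoid homomorphisms $\mathrm{Array}(A)\to X$ and functions $A\to X$.
   Context: $\mathrm{Fin}(n)$ is the standard finite set $\{0,\dots,n-1\}$; $\lambda\{\}$ is the unique function out of $\mathrm{Fin}(0)$. Work in univalent type theory with sets. -}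

module Defs where

open import Level using (Level; _⊔_)
open import Data.Nat using (ℕ; zero; suc; _+_; _<?_)
open import Data.Nat.Properties using (≮⇒≥)
open import Data.Fin using (Fin; toℕ; fromℕ<; reduce≥)
open import Data.Product using (Σ; _,_)
open import Relation.Nullary using (yes; no)
open import Relation.Binary.PropositionalEquality using (_≡_; subst)
open import Algebra.Bundles using (Monoid)
open import Algebra.Structures using (IsMonoid)
open import Function.Structures using (IsInverse)

Array : ∀ {a} → Set a → Set a
Array A = Σ ℕ (λ n → Fin n → A)

module _ {a} {A : Set a} where

  unit : Array A
  unit = 0 , λ ()

  η : A → Array A
  η x = 1 , λ _ → x

  _⊕_ : ∀ {n m} → (Fin n → A) → (Fin m → A) → Fin (n + m) → A
  _⊕_ {n} f g k with toℕ k <? n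
  ... | yes k<n = f (fromℕ< k<n)
  ... | no k≮n = g (reduce≥ k (≮⇒≥ k≮n))

  _++_ : Array A → Array A → Array A
  (n , f) ++ (m , g) = (n + m) , (f ⊕ g)

  -- Identity of Array(A) (what the identity type of the Σ-type is,
  -- via function extensionality): equal lengths and pointwise equal entries.
  _≈ᴬ_ : Array A → Array A → Set a
  (n , f) ≈ᴬ (m , g) = Σ (n ≡ m) (λ p → ∀ i → f i ≡ g (subst Fin p i))

record MonoidHom {a c ℓ} (A : Set a) (X : Monoid c ℓ) : Set (a ⊔ c ⊔ ℓ) where
  open Monoid X
  field
    fun    : Array A → Carrier
    cong   : ∀ {u v} → u ≈ᴬ v → fun u ≈ fun v
    ε-hom  : fun unit ≈ ε
    ∙-hom  : ∀ u v → fun (u ++ v) ≈ (fun u ∙ fun v)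
open MonoidHom public

module _ {a c ℓ} {A : Set a} (X : Monoid c ℓ) where
  open Monoid X

  _≈ᴴ_ : MonoidHom A X → MonoidHom A X → Set (a ⊔ ℓ)
  h ≈ᴴ k = ∀ u → fun h u ≈ fun k u

  _≈ᶠ_ : (A → Carrier) → (A → Carrier) → Set (a ⊔ ℓ)
  f ≈ᶠ g = ∀ x → f x ≈ g x

  restrict : MonoidHom A X → (A → Carrier)
  restrict h x = fun h (η x)

  RestrictIsEquiv : Set (a ⊔ c ⊔ ℓ)
  RestrictIsEquiv = Σ ((A → Carrier) → MonoidHom A X) (λ from → IsInverse _≈ᴴ_ _≈ᶠ_ restrict from)

-- Concatenation ⊕ agrees with the standard library's Vector._++_, so it is
-- determined by its values on the two blocks i ↑ˡ m and n ↑ʳ j; the monoid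
-- laws then only require locating the blocks of an index under the casts
-- of n + m + o ≡ n + (m + o) and n + 0 ≡ n. The extension of φ : A → X is
-- the fold of φ over an array, and a homomorphism agrees with the fold of
-- its restriction because (suc n , f) splits as η (f zero) ++ (n , tail f).
module Submission where

open import Defs
open import Algebra.Bundles using (Monoid)
open import Algebra.Structures using (IsMonoid)
open import Data.Nat using (zero; suc; _+_; _<?_)
open import Data.Nat.Properties using (+-assoc; +-identityʳ; ≮⇒≥)
open import Data.Fin using (Fin; zero; suc; toℕ; cast; _↑ˡ_; _↑ʳ_; splitAt)
open import Data.Fin.Properties using (toℕ-injective; toℕ-cast; toℕ-↑ˡ; toℕ-↑ʳ; subst-is-cast; join-splitAt)
open import Data.Product using (_×_; _,_; proj₂)
open import Data.Sum using (inj₁; inj₂)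
open import Data.Vec.Functional as Vector using (tail)
open import Data.Vec.Functional.Properties using (lookup-++-<; lookup-++-≥; lookup-++ˡ; lookup-++ʳ)
open import Function using (_∘_)
open import Relation.Binary.Structures using (IsEquivalence)
import Relation.Binary.Construct.On as On
open import Relation.Nullary using (yes; no)
open import Relation.Binary.PropositionalEquality as ≡ using (_≡_; _≗_; refl)

≗-from-↑ˡ-↑ʳ : ∀ {b} {B : Set b} n {m} {h h′ : Fin (n + m) → B} →
               (∀ i → h (i ↑ˡ m) ≡ h′ (i ↑ˡ m)) → (∀ j → h (n ↑ʳ j) ≡ h′ (n ↑ʳ j)) → h ≗ h′
≗-from-↑ˡ-↑ʳ n {m} onˡ onʳ k with splitAt n k | join-splitAt n m k
... | inj₁ i | refl = onˡ i
... | inj₂ j | refl = onʳ j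

toℕ≡⇒cast≡ : ∀ {n m} .(p : n ≡ m) {i : Fin n} {j : Fin m} → toℕ i ≡ toℕ j → cast p i ≡ j
toℕ≡⇒cast≡ p {i} e = toℕ-injective (≡.trans (toℕ-cast p i) e)

↑ˡ-↑ˡ-assoc : ∀ {n} m o (i : Fin n) → cast (+-assoc n m o) ((i ↑ˡ m) ↑ˡ o) ≡ i ↑ˡ (m + o)
↑ˡ-↑ˡ-assoc m o i = toℕ≡⇒cast≡ _ (begin
  toℕ ((i ↑ˡ m) ↑ˡ o)  ≡⟨ toℕ-↑ˡ (i ↑ˡ m) o ⟩
  toℕ (i ↑ˡ m)         ≡⟨ toℕ-↑ˡ i m ⟩
  toℕ i                ≡⟨ toℕ-↑ˡ i (m + o) ⟨
  toℕ (i ↑ˡ (m + o))   ∎)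
  where open ≡.≡-Reasoning

↑ʳ-↑ˡ-assoc : ∀ n {m} o (j : Fin m) → cast (+-assoc n m o) ((n ↑ʳ j) ↑ˡ o) ≡ n ↑ʳ (j ↑ˡ o)
↑ʳ-↑ˡ-assoc n o j = toℕ≡⇒cast≡ _ (begin
  toℕ ((n ↑ʳ j) ↑ˡ o)  ≡⟨ toℕ-↑ˡ (n ↑ʳ j) o ⟩
  toℕ (n ↑ʳ j)         ≡⟨ toℕ-↑ʳ n j ⟩
  n + toℕ j            ≡⟨ ≡.cong (n +_) (toℕ-↑ˡ j o) ⟨
  n + toℕ (j ↑ˡ o)     ≡⟨ toℕ-↑ʳ n (j ↑ˡ o) ⟨
  toℕ (n ↑ʳ (j ↑ˡ o))  ∎)
  where open ≡.≡-Reasoning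

↑ʳ-↑ʳ-assoc : ∀ n m {o} (k : Fin o) → cast (+-assoc n m o) ((n + m) ↑ʳ k) ≡ n ↑ʳ (m ↑ʳ k)
↑ʳ-↑ʳ-assoc n m k = toℕ≡⇒cast≡ _ (begin
  toℕ ((n + m) ↑ʳ k)   ≡⟨ toℕ-↑ʳ (n + m) k ⟩
  n + m + toℕ k        ≡⟨ +-assoc n m (toℕ k) ⟩
  n + (m + toℕ k)      ≡⟨ ≡.cong (n +_) (toℕ-↑ʳ m k) ⟨
  n + toℕ (m ↑ʳ k)     ≡⟨ toℕ-↑ʳ n (m ↑ʳ k) ⟨
  toℕ (n ↑ʳ (m ↑ʳ k))  ∎)
  where open ≡.≡-Reasoning

module _ {a} {A : Set a} where

  ⊕≗++ : ∀ {n m} (f : Fin n → A) (g : Fin m → A) → f ⊕ g ≗ f Vector.++ g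
  ⊕≗++ {n} f g k with toℕ k <? n
  ... | yes k<n = ≡.sym (lookup-++-< f g k k<n)
  ... | no k≮n  = ≡.sym (lookup-++-≥ f g k (≮⇒≥ k≮n))

  ⊕-↑ˡ : ∀ {n m} (f : Fin n → A) (g : Fin m → A) i → (f ⊕ g) (i ↑ˡ m) ≡ f i
  ⊕-↑ˡ f g i = ≡.trans (⊕≗++ f g _) (lookup-++ˡ f g i)

  ⊕-↑ʳ : ∀ {n m} (f : Fin n → A) (g : Fin m → A) j → (f ⊕ g) (n ↑ʳ j) ≡ g j
  ⊕-↑ʳ f g j = ≡.trans (⊕≗++ f g _) (lookup-++ʳ f g j)

  ⊕-cong : ∀ {n m} {f f′ : Fin n → A} {g g′ : Fin m → A} → f ≗ f′ → g ≗ g′ → f ⊕ g ≗ f′ ⊕ g′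
  ⊕-cong {n} {f = f} {f′} {g} {g′} f≗f′ g≗g′ = ≗-from-↑ˡ-↑ʳ n
    (λ i → ≡.trans (⊕-↑ˡ f g i) (≡.trans (f≗f′ i) (≡.sym (⊕-↑ˡ f′ g′ i))))
    (λ j → ≡.trans (⊕-↑ʳ f g j) (≡.trans (g≗g′ j) (≡.sym (⊕-↑ʳ f′ g′ j))))

  ⊕-identityˡ : ∀ {n} (e : Fin 0 → A) (f : Fin n → A) → e ⊕ f ≗ f
  ⊕-identityˡ e f = ≗-from-↑ˡ-↑ʳ 0 (λ ()) (⊕-↑ʳ e f)

  ⊕-identityʳ : ∀ {n} (f : Fin n → A) (e : Fin 0 → A) → f ⊕ e ≗ f ∘ cast (+-identityʳ n)
  ⊕-identityʳ {n} f e = ≗-from-↑ˡ-↑ʳ n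
    (λ i → ≡.trans (⊕-↑ˡ f e i) (≡.cong f (≡.sym (toℕ≡⇒cast≡ _ (toℕ-↑ˡ i 0)))))
    (λ ())

  ⊕-assoc : ∀ {n m o} (f : Fin n → A) (g : Fin m → A) (h : Fin o → A) →
            (f ⊕ g) ⊕ h ≗ (f ⊕ (g ⊕ h)) ∘ cast (+-assoc n m o)
  ⊕-assoc {n} {m} {o} f g h = ≗-from-↑ˡ-↑ʳ (n + m) (≗-from-↑ˡ-↑ʳ n inF inG) inH
    where
    open ≡.≡-Reasoning
    inF : ∀ i → ((f ⊕ g) ⊕ h) ((i ↑ˡ m) ↑ˡ o) ≡ (f ⊕ (g ⊕ h)) (cast _ ((i ↑ˡ m) ↑ˡ o))
    inF i = begin
      ((f ⊕ g) ⊕ h) ((i ↑ˡ m) ↑ˡ o)  ≡⟨ ⊕-↑ˡ (f ⊕ g) h (i ↑ˡ m) ⟩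
      (f ⊕ g) (i ↑ˡ m)              ≡⟨ ⊕-↑ˡ f g i ⟩
      f i                           ≡⟨ ⊕-↑ˡ f (g ⊕ h) i ⟨
      (f ⊕ (g ⊕ h)) (i ↑ˡ (m + o))  ≡⟨ ≡.cong (f ⊕ (g ⊕ h)) (↑ˡ-↑ˡ-assoc m o i) ⟨
      (f ⊕ (g ⊕ h)) (cast _ ((i ↑ˡ m) ↑ˡ o))  ∎
    inG : ∀ j → ((f ⊕ g) ⊕ h) ((n ↑ʳ j) ↑ˡ o) ≡ (f ⊕ (g ⊕ h)) (cast _ ((n ↑ʳ j) ↑ˡ o))
    inG j = begin
      ((f ⊕ g) ⊕ h) ((n ↑ʳ j) ↑ˡ o)  ≡⟨ ⊕-↑ˡ (f ⊕ g) h (n ↑ʳ j) ⟩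
      (f ⊕ g) (n ↑ʳ j)              ≡⟨ ⊕-↑ʳ f g j ⟩
      g j                           ≡⟨ ⊕-↑ˡ g h j ⟨
      (g ⊕ h) (j ↑ˡ o)              ≡⟨ ⊕-↑ʳ f (g ⊕ h) (j ↑ˡ o) ⟨
      (f ⊕ (g ⊕ h)) (n ↑ʳ (j ↑ˡ o))  ≡⟨ ≡.cong (f ⊕ (g ⊕ h)) (↑ʳ-↑ˡ-assoc n o j) ⟨
      (f ⊕ (g ⊕ h)) (cast _ ((n ↑ʳ j) ↑ˡ o))  ∎
    inH : ∀ k → ((f ⊕ g) ⊕ h) ((n + m) ↑ʳ k) ≡ (f ⊕ (g ⊕ h)) (cast _ ((n + m) ↑ʳ k))
    inH k = begin
      ((f ⊕ g) ⊕ h) ((n + m) ↑ʳ k)  ≡⟨ ⊕-↑ʳ (f ⊕ g) h k ⟩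
      h k                          ≡⟨ ⊕-↑ʳ g h k ⟨
      (g ⊕ h) (m ↑ʳ k)             ≡⟨ ⊕-↑ʳ f (g ⊕ h) (m ↑ʳ k) ⟨
      (f ⊕ (g ⊕ h)) (n ↑ʳ (m ↑ʳ k))  ≡⟨ ≡.cong (f ⊕ (g ⊕ h)) (↑ʳ-↑ʳ-assoc n m k) ⟨
      (f ⊕ (g ⊕ h)) (cast _ ((n + m) ↑ʳ k))  ∎

  tail-⊕ : ∀ {n m} (f : Fin (suc n) → A) (g : Fin m → A) → tail (f ⊕ g) ≗ tail f ⊕ g
  tail-⊕ {n} f g = ≗-from-↑ˡ-↑ʳ n
    (λ i → ≡.trans (⊕-↑ˡ f g (suc i)) (≡.sym (⊕-↑ˡ (tail f) g i)))
    (λ j → ≡.trans (⊕-↑ʳ f g j) (≡.sym (⊕-↑ʳ (tail f) g j)))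

  head-⊕-tail : ∀ {n} (f : Fin (suc n) → A) → f ≗ (λ _ → f zero) ⊕ tail f
  head-⊕-tail f = ≗-from-↑ˡ-↑ʳ 1
    (λ { zero → ≡.sym (⊕-↑ˡ head (tail f) zero) })
    (λ j → ≡.sym (⊕-↑ʳ head (tail f) j))
    where
    head : Fin 1 → A
    head _ = f zero

∘-⊕ : ∀ {a b} {A : Set a} {B : Set b} (φ : A → B) {n m} (f : Fin n → A) (g : Fin m → A) →
      φ ∘ (f ⊕ g) ≗ (φ ∘ f) ⊕ (φ ∘ g)
∘-⊕ φ {n} f g = ≗-from-↑ˡ-↑ʳ n
  (λ i → ≡.trans (≡.cong φ (⊕-↑ˡ f g i)) (≡.sym (⊕-↑ˡ (φ ∘ f) (φ ∘ g) i)))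
  (λ j → ≡.trans (≡.cong φ (⊕-↑ʳ f g j)) (≡.sym (⊕-↑ʳ (φ ∘ f) (φ ∘ g) j)))

module _ {a} {A : Set a} where

  ≈ᴬ-by-cast : ∀ {n m} (f : Fin n → A) (g : Fin m → A) (p : n ≡ m) → f ≗ g ∘ cast p → (n , f) ≈ᴬ (m , g)
  ≈ᴬ-by-cast f g p f≗g = p , λ i → ≡.trans (f≗g i) (≡.cong g (≡.sym (subst-is-cast p i)))

  ≈ᴬ-sym : ∀ {u v : Array A} → u ≈ᴬ v → v ≈ᴬ u
  ≈ᴬ-sym {_ , _} {_ , _} (refl , f≗g) = refl , ≡.sym ∘ f≗g

  ≈ᴬ-trans : ∀ {u v w : Array A} → u ≈ᴬ v → v ≈ᴬ w → u ≈ᴬ w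
  ≈ᴬ-trans {_ , _} {_ , _} {_ , _} (refl , f≗g) (refl , g≗h) = refl , λ i → ≡.trans (f≗g i) (g≗h i)

  ≈ᴬ-isEquivalence : IsEquivalence (_≈ᴬ_ {A = A})
  ≈ᴬ-isEquivalence = record
    { refl  = refl , λ _ → refl
    ; sym   = λ {u} {v} → ≈ᴬ-sym {u} {v}
    ; trans = λ {u} {v} {w} → ≈ᴬ-trans {u} {v} {w}
    }

  ++-cong : ∀ {u u′ v v′ : Array A} → u ≈ᴬ u′ → v ≈ᴬ v′ → (u ++ v) ≈ᴬ (u′ ++ v′)
  ++-cong {_ , _} {_ , _} {_ , _} {_ , _} (refl , f≗f′) (refl , g≗g′) = refl , ⊕-cong f≗f′ g≗g′

  ++-assoc : ∀ (u v w : Array A) → ((u ++ v) ++ w) ≈ᴬ (u ++ (v ++ w))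
  ++-assoc (n , f) (m , g) (o , h) = ≈ᴬ-by-cast ((f ⊕ g) ⊕ h) (f ⊕ (g ⊕ h)) (+-assoc n m o) (⊕-assoc f g h)

  ++-identityˡ : ∀ (u : Array A) → (unit ++ u) ≈ᴬ u
  ++-identityˡ (_ , f) = refl , ⊕-identityˡ (proj₂ unit) f

  ++-identityʳ : ∀ (u : Array A) → (u ++ unit) ≈ᴬ u
  ++-identityʳ (n , f) = ≈ᴬ-by-cast _ f (+-identityʳ n) (⊕-identityʳ f _)

  ++-isMonoid : IsMonoid (_≈ᴬ_ {A = A}) _++_ unit
  ++-isMonoid = record
    { isSemigroup = record
      { isMagma = record { isEquivalence = ≈ᴬ-isEquivalence ; ∙-cong = λ {u} {u′} {v} {v′} → ++-cong {u} {u′} {v} {v′} }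
      ; assoc   = ++-assoc
      }
    ; identity = ++-identityˡ , ++-identityʳ
    }

module _ {c ℓ} (X : Monoid c ℓ) where
  open Monoid X renaming (refl to ≈-refl; sym to ≈-sym; trans to ≈-trans)
  open import Algebra.Properties.Monoid.Sum X using (sum; sum-cong-≗; sum-cong-≋)
  open import Relation.Binary.Reasoning.Setoid setoid

  sum-⊕ : ∀ {n m} (u : Fin n → Carrier) (v : Fin m → Carrier) → sum (u ⊕ v) ≈ sum u ∙ sum v
  sum-⊕ {zero} u v = begin
    sum (u ⊕ v)  ≡⟨ sum-cong-≗ (⊕-identityˡ u v) ⟩
    sum v        ≈⟨ identityˡ (sum v) ⟨
    ε ∙ sum v    ∎
  sum-⊕ {suc n} u v = begin
    (u ⊕ v) zero ∙ sum (tail (u ⊕ v))  ≡⟨ ≡.cong₂ _∙_ (⊕-↑ˡ u v zero) (sum-cong-≗ (tail-⊕ u v)) ⟩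
    u zero ∙ sum (tail u ⊕ v)          ≈⟨ ∙-congˡ (sum-⊕ (tail u) v) ⟩
    u zero ∙ (sum (tail u) ∙ sum v)    ≈⟨ assoc _ _ _ ⟨
    u zero ∙ sum (tail u) ∙ sum v      ∎

  pointwise-isEquivalence : ∀ {i} {I : Set i} → IsEquivalence (λ (u v : I → Carrier) → ∀ x → u x ≈ v x)
  pointwise-isEquivalence = record
    { refl  = λ _ → ≈-refl
    ; sym   = λ u≈v x → ≈-sym (u≈v x)
    ; trans = λ u≈v v≈w x → ≈-trans (u≈v x) (v≈w x)
    }

  module _ {a} {A : Set a} where

    extend : (A → Carrier) → MonoidHom A X
    extend φ = record
      { fun   = λ (n , f) → sum (φ ∘ f)
      ; cong  = λ { {n , f} {.n , g} (refl , f≗g) → reflexive (sum-cong-≗ (≡.cong φ ∘ f≗g)) }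
      ; ε-hom = ≈-refl
      ; ∙-hom = λ (n , f) (m , g) → ≈-trans (reflexive (sum-cong-≗ (∘-⊕ φ f g))) (sum-⊕ (φ ∘ f) (φ ∘ g))
      }

    fun≈sum∘restrict : (h : MonoidHom A X) → ∀ n (f : Fin n → A) → fun h (n , f) ≈ sum (restrict X h ∘ f)
    fun≈sum∘restrict h zero f = ≈-trans (MonoidHom.cong h {v = unit} (refl , λ ())) (ε-hom h)
    fun≈sum∘restrict h (suc n) f = begin
      fun h (suc n , f)                               ≈⟨ MonoidHom.cong h (refl , head-⊕-tail f) ⟩
      fun h (η (f zero) ++ (n , tail f))              ≈⟨ ∙-hom h (η (f zero)) (n , tail f) ⟩
      fun h (η (f zero)) ∙ fun h (n , tail f)         ≈⟨ ∙-congˡ (fun≈sum∘restrict h n (tail f)) ⟩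
      restrict X h (f zero) ∙ sum (restrict X h ∘ tail f)  ∎

    restrict-isEquiv : RestrictIsEquiv X
    restrict-isEquiv = extend , record
      { isLeftInverse = record
        { isCongruent = record
          { cong           = λ h≈k x → h≈k (η x)
          ; isEquivalence₁ = On.isEquivalence fun pointwise-isEquivalence
          ; isEquivalence₂ = pointwise-isEquivalence
          }
        ; from-cong = λ φ≈ψ (n , f) → sum-cong-≋ (φ≈ψ ∘ f)
        ; inverseˡ  = λ h≈extendφ x → ≈-trans (h≈extendφ (η x)) (identityʳ _)
        }
      ; inverseʳ = λ { {h} φ≈restricth (n , f) → ≈-trans (sum-cong-≋ (φ≈restricth ∘ f)) (≈-sym (fun≈sum∘restrict h n f)) }
      }

proposition26 : ∀ {a c ℓ} (A : Set a) → IsMonoid (_≈ᴬ_ {A = A}) _++_ unit × ((X : Monoid c ℓ) → RestrictIsEquiv {A = A} X)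
proposition26 A = ++-isMonoid , λ X → restrict-isEquiv X
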